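{- Let $S\subseteq\mathbb{Z}_2^\alpha\times\mathbb{Z}_2[u]^\beta$ and let $C$ be the $\mathbb{Z}_2$-linear code spanned by $\Psi(S)$. Then $\Psi^{ -1}(C)$ is a $\mathbb{Z}_2\mathbb{Z}_2[u]$-additive code with parameters $(\alpha,\beta)$ (i.e. $C$ is $\mathbb{Z}_2\mathbb{Z}_2[u]$-linear with parameters $(\alpha,\beta)$ with respect to the given coordinate arrangement) if and only if $\Psi(u\mathbf{x})\in C$ for all $\mathbf{x}\in S$.
   Context: $\mathbb{Z}_2[u]=\{0,1,u,1+u\}$ is the ring with $u^2=0$; $\pi:\mathbb{Z}_2[u]\to\mathbb{Z}_2$ has $\pi(0)=\pi(u)=0$, $\pi(1)=\pi(1+u)=1$. $\mathbb{Z}_2^\alpha\times\mathbb{Z}_2[u]^\beta$ is a $\mathbb{Z}_2[u]$-module with componentwise addition and scalar multiplication $\lambda(x_1,\dots,x_\alpha\mid x'_1,\dots,x'_\beta)=(\pi(\lambda)x_1,\dots,\pi(\lambda)x_\alpha\mid\lambda x'_1,\dots,\lambda x'_\beta)$; a $\mathbb{Z}_2\mathbb{Z}_2[u]$-additive code with parameters $(\alpha,\beta)$ is a $\mathbb{Z}_2[u]$-submodule of it. $\psi:\mathbb{Z}_2[u]\to\mathbb{Z}_2^2$ is $\psi(0)=(0,0)$, $\psi(1)=(0,1)$, $\psi(u)=(1,1)$, $\psi(1+u)=(1,0)$, extended coordinatewise, and $\Psi(x\mid x')=(x\mid\psi(x'))$, a bijection $\mathbb{Z}_2^\alpha\times\mathbb{Z}_2[u]^\beta\to\mathbb{Z}_2^{\alpha+2\beta}$.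 -}

module Defs where

open import Data.Bool using (Bool; true; false; _xor_; _∧_)
open import Data.Nat using (ℕ; _+_; _*_)
open import Data.Vec using (Vec; []; _∷_; _++_; zipWith; map; replicate)
open import Data.Product using (_×_; _,_; Σ-syntax)
open import Relation.Binary.PropositionalEquality using (_≡_)

-- The ring Z2[u] = {0, 1, u, 1+u} with u² = 0.
data Z2u : Set where
  𝟘 𝟙 𝕦 𝟙+𝕦 : Z2u

_⊕_ : Z2u → Z2u → Z2u
𝟘 ⊕ y = y
x ⊕ 𝟘 = x
𝟙 ⊕ 𝟙 = 𝟘
𝟙 ⊕ 𝕦 = 𝟙+𝕦
𝟙 ⊕ 𝟙+𝕦 = 𝕦
𝕦 ⊕ 𝟙 = 𝟙+𝕦
𝕦 ⊕ 𝕦 = 𝟘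
𝕦 ⊕ 𝟙+𝕦 = 𝟙
𝟙+𝕦 ⊕ 𝟙 = 𝕦
𝟙+𝕦 ⊕ 𝕦 = 𝟙
𝟙+𝕦 ⊕ 𝟙+𝕦 = 𝟘

_⊗_ : Z2u → Z2u → Z2u
𝟘 ⊗ y = 𝟘
𝟙 ⊗ y = y
𝕦 ⊗ 𝟘 = 𝟘
𝕦 ⊗ 𝟙 = 𝕦
𝕦 ⊗ 𝕦 = 𝟘
𝕦 ⊗ 𝟙+𝕦 = 𝕦
𝟙+𝕦 ⊗ 𝟘 = 𝟘
𝟙+𝕦 ⊗ 𝟙 = 𝟙+𝕦
𝟙+𝕦 ⊗ 𝕦 = 𝕦
𝟙+𝕦 ⊗ 𝟙+𝕦 = 𝟙

-- π : Z2[u] → Z2  (Z2 modelled as Bool with xor as addition, ∧ as product)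
π : Z2u → Bool
π 𝟘 = false
π 𝟙 = true
π 𝕦 = false
π 𝟙+𝕦 = true

Elem : ℕ → ℕ → Set
Elem α β = Vec Bool α × Vec Z2u β

_+ᴱ_ : ∀ {α β} → Elem α β → Elem α β → Elem α β
(x , x') +ᴱ (y , y') = zipWith _xor_ x y , zipWith _⊕_ x' y'

0ᴱ : ∀ {α β} → Elem α β
0ᴱ = replicate _ false , replicate _ 𝟘

_·ᴱ_ : ∀ {α β} → Z2u → Elem α β → Elem α β
l ·ᴱ (x , x') = map (π l ∧_) x , map (l ⊗_) x'

record IsAdditiveCode {α β : ℕ} (D : Elem α β → Set) : Set where
  field
    has-zero : D 0ᴱ
    +-closed : ∀ x y → D x → D y → D (x +ᴱ y)
    ·-closed : ∀ (l : Z2u) x → D x → D (l ·ᴱ x)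

ψ : Z2u → Vec Bool 2
ψ 𝟘 = false ∷ false ∷ []
ψ 𝟙 = false ∷ true ∷ []
ψ 𝕦 = true ∷ true ∷ []
ψ 𝟙+𝕦 = true ∷ false ∷ []

ψᵛ : ∀ {β} → Vec Z2u β → Vec Bool (β * 2)
ψᵛ [] = []
ψᵛ (a ∷ as) = ψ a ++ ψᵛ as

Ψ : ∀ {α β} → Elem α β → Vec Bool (α + β * 2)
Ψ (x , x') = x ++ ψᵛ x'

-- The Z2-linear code spanned by a set T of binary vectors: the smallest
-- subset containing T, 0, and closed under addition (over Z2 the only
-- scalars are 0 and 1, so this is exactly the Z2-span).
data Span {n : ℕ} (T : Vec Bool n → Set) : Vec Bool n → Set where
  span-zero : Span T (replicate n false)
  span-gen  : ∀ {v} → T v → Span T v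
  span-add  : ∀ {v w} → Span T v → Span T w → Span T (zipWith _xor_ v w)

ΨImage : ∀ {α β} → (Elem α β → Set) → Vec Bool (α + β * 2) → Set
ΨImage {α} {β} S v = Σ[ s ∈ Elem α β ] (S s × Ψ s ≡ v)

ΨPre : ∀ {α β} → (Vec Bool (α + β * 2) → Set) → Elem α β → Set
ΨPre C x = C (Ψ x)

-- Over Z₂[u] every scalar is 0, 1, u or 1 + u, so a subgroup of Z₂^α × Z₂[u]^β is a
-- submodule as soon as it is closed under multiplication by u. The Gray map Ψ is
-- additive, hence Ψ⁻¹(C) is always a subgroup, and it carries multiplication by u to
-- a Z₂-linear map on binary vectors. A linear map preserves the span of S as soon as
-- it sends the generators Ψ(S) into it, which is the stated condition.
module Submission where

open import Defs
open import Algebra.Bundles using (CommutativeRing)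
open import Data.Bool using (Bool; true; false; _xor_; _∧_)
open import Data.Bool.Properties using (xor-∧-commutativeRing; xor-identityʳ)
open import Data.Nat using (ℕ; zero; suc; _+_; _*_)
open import Data.Product using (_,_)
open import Data.Vec using (Vec; []; _∷_; _++_; zipWith; map; replicate)
open import Data.Vec.Properties using (map-id; map-const; map-cong; zipWith-++)
open import Function.Bundles using (_⇔_; mk⇔)
open import Relation.Binary.PropositionalEquality
  using (_≡_; refl; sym; trans; cong; cong₂; subst)

open import Algebra.Properties.CommutativeSemigroup
  (CommutativeRing.+-commutativeSemigroup xor-∧-commutativeRing)
  using (interchange)

private
  variable
    A B C : Set
    m n : ℕ

record IsLinearCode (L : Vec Bool n → Set) : Set where
  field
    zero-mem   : L (replicate n false)
    xor-closed : ∀ {v w} → L v → L w → L (zipWith _xor_ v w)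

record IsLinearMap (f : Vec Bool m → Vec Bool n) : Set where
  field
    map-zero : f (replicate m false) ≡ replicate n false
    map-xor  : ∀ v w → f (zipWith _xor_ v w) ≡ zipWith _xor_ (f v) (f w)

Span-isLinearCode : (T : Vec Bool n → Set) → IsLinearCode (Span T)
Span-isLinearCode T = record { zero-mem = span-zero ; xor-closed = span-add }

module _ {T : Vec Bool m → Set} {L : Vec Bool n → Set} {f : Vec Bool m → Vec Bool n}
         (f-lin : IsLinearMap f) (L-lin : IsLinearCode L) (gen : ∀ {v} → T v → L (f v)) where
  open IsLinearMap f-lin
  open IsLinearCode L-lin

  Span-map : ∀ {v} → Span T v → L (f v)
  Span-map span-zero              = subst L (sym map-zero) zero-mem
  Span-map (span-gen t)           = gen t
  Span-map (span-add {v} {w} p q) = subst L (sym (map-xor v w)) (xor-closed (Span-map p) (Span-map q))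

ψ-⊕ : ∀ a b → ψ (a ⊕ b) ≡ zipWith _xor_ (ψ a) (ψ b)
ψ-⊕ 𝟘   𝟘   = refl
ψ-⊕ 𝟘   𝟙   = refl
ψ-⊕ 𝟘   𝕦   = refl
ψ-⊕ 𝟘   𝟙+𝕦 = refl
ψ-⊕ 𝟙   𝟘   = refl
ψ-⊕ 𝟙   𝟙   = refl
ψ-⊕ 𝟙   𝕦   = refl
ψ-⊕ 𝟙   𝟙+𝕦 = refl
ψ-⊕ 𝕦   𝟘   = refl
ψ-⊕ 𝕦   𝟙   = refl
ψ-⊕ 𝕦   𝕦   = refl
ψ-⊕ 𝕦   𝟙+𝕦 = refl
ψ-⊕ 𝟙+𝕦 𝟘   = refl
ψ-⊕ 𝟙+𝕦 𝟙   = refl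
ψ-⊕ 𝟙+𝕦 𝕦   = refl
ψ-⊕ 𝟙+𝕦 𝟙+𝕦 = refl

ψᵛ-⊕ : (x y : Vec Z2u n) → ψᵛ (zipWith _⊕_ x y) ≡ zipWith _xor_ (ψᵛ x) (ψᵛ y)
ψᵛ-⊕ []      []      = refl
ψᵛ-⊕ (a ∷ x) (b ∷ y) =
  trans (cong₂ _++_ (ψ-⊕ a b) (ψᵛ-⊕ x y)) (sym (zipWith-++ _xor_ (ψ a) (ψᵛ x) (ψ b) (ψᵛ y)))

ψᵛ-𝟘 : ∀ n → ψᵛ (replicate n 𝟘) ≡ replicate (n * 2) false
ψᵛ-𝟘 zero    = refl
ψᵛ-𝟘 (suc n) = cong (λ v → false ∷ false ∷ v) (ψᵛ-𝟘 n)

Ψ-0ᴱ : ∀ α β → Ψ (0ᴱ {α} {β}) ≡ replicate (α + β * 2) false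
Ψ-0ᴱ zero    β = ψᵛ-𝟘 β
Ψ-0ᴱ (suc α) β = cong (false ∷_) (Ψ-0ᴱ α β)

Ψ-+ᴱ : ∀ {α β} (x y : Elem α β) → Ψ (x +ᴱ y) ≡ zipWith _xor_ (Ψ x) (Ψ y)
Ψ-+ᴱ (x , x') (y , y') =
  trans (cong (zipWith _xor_ x y ++_) (ψᵛ-⊕ x' y')) (sym (zipWith-++ _xor_ x (ψᵛ x') y (ψᵛ y')))

module _ (α β : ℕ) {L : Vec Bool (α + β * 2) → Set} (L-lin : IsLinearCode L) where
  open IsLinearCode L-lin

  ΨPre-0ᴱ : ΨPre {α} {β} L 0ᴱ
  ΨPre-0ᴱ = subst L (sym (Ψ-0ᴱ α β)) zero-mem

  ΨPre-+ᴱ : ∀ x y → ΨPre {α} {β} L x → ΨPre L y → ΨPre L (x +ᴱ y)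
  ΨPre-+ᴱ x y p q = subst L (sym (Ψ-+ᴱ x y)) (xor-closed p q)

-- Multiplication by u in Gray coordinates: ψ(u a) = (s , s), where s is the sum of the
-- two bits of ψ(a).
u·ψᵛ : ∀ n → Vec Bool (n * 2) → Vec Bool (n * 2)
u·ψᵛ zero    []          = []
u·ψᵛ (suc n) (a ∷ b ∷ v) = (a xor b) ∷ (a xor b) ∷ u·ψᵛ n v

u·Ψ : ∀ α β → Vec Bool (α + β * 2) → Vec Bool (α + β * 2)
u·Ψ zero    β v       = u·ψᵛ β v
u·Ψ (suc α) β (_ ∷ v) = false ∷ u·Ψ α β v

u·ψᵛ-ψᵛ : (x : Vec Z2u n) → u·ψᵛ n (ψᵛ x) ≡ ψᵛ (map (𝕦 ⊗_) x)
u·ψᵛ-ψᵛ []        = refl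
u·ψᵛ-ψᵛ (𝟘 ∷ x)   = cong (λ v → false ∷ false ∷ v) (u·ψᵛ-ψᵛ x)
u·ψᵛ-ψᵛ (𝟙 ∷ x)   = cong (λ v → true ∷ true ∷ v) (u·ψᵛ-ψᵛ x)
u·ψᵛ-ψᵛ (𝕦 ∷ x)   = cong (λ v → false ∷ false ∷ v) (u·ψᵛ-ψᵛ x)
u·ψᵛ-ψᵛ (𝟙+𝕦 ∷ x) = cong (λ v → true ∷ true ∷ v) (u·ψᵛ-ψᵛ x)

u·Ψ-Ψ : ∀ {α β} (x : Elem α β) → u·Ψ α β (Ψ x) ≡ Ψ (𝕦 ·ᴱ x)
u·Ψ-Ψ ([]    , x') = u·ψᵛ-ψᵛ x'
u·Ψ-Ψ (_ ∷ x , x') = cong (false ∷_) (u·Ψ-Ψ (x , x'))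

u·ψᵛ-isLinearMap : ∀ n → IsLinearMap (u·ψᵛ n)
u·ψᵛ-isLinearMap n = record { map-zero = zero-to-zero n ; map-xor = xor-to-xor n }
  where
  zero-to-zero : ∀ n → u·ψᵛ n (replicate (n * 2) false) ≡ replicate (n * 2) false
  zero-to-zero zero    = refl
  zero-to-zero (suc n) = cong (λ v → false ∷ false ∷ v) (zero-to-zero n)

  xor-to-xor : ∀ n v w →
    u·ψᵛ n (zipWith _xor_ v w) ≡ zipWith _xor_ (u·ψᵛ n v) (u·ψᵛ n w)
  xor-to-xor zero    []          []          = refl
  xor-to-xor (suc n) (a ∷ b ∷ v) (c ∷ d ∷ w) =
    cong₂ (λ s u → s ∷ s ∷ u) (interchange a c b d) (xor-to-xor n v w)

u·Ψ-isLinearMap : ∀ α β → IsLinearMap (u·Ψ α β)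
u·Ψ-isLinearMap zero    β = u·ψᵛ-isLinearMap β
u·Ψ-isLinearMap (suc α) β = record
  { map-zero = cong (false ∷_) map-zero
  ; map-xor  = λ { (_ ∷ v) (_ ∷ w) → cong (false ∷_) (map-xor v w) }
  }
  where open IsLinearMap (u·Ψ-isLinearMap α β)

zipWith-map-self : (f : A → B → C) (g : A → B) (xs : Vec A n) →
  zipWith f xs (map g xs) ≡ map (λ a → f a (g a)) xs
zipWith-map-self f g []       = refl
zipWith-map-self f g (x ∷ xs) = cong (f x (g x) ∷_) (zipWith-map-self f g xs)

𝟘·ᴱ : ∀ {α β} (x : Elem α β) → 𝟘 ·ᴱ x ≡ 0ᴱ
𝟘·ᴱ (x , x') = cong₂ _,_ (map-const x false) (map-const x' 𝟘)

𝟙·ᴱ : ∀ {α β} (x : Elem α β) → 𝟙 ·ᴱ x ≡ x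
𝟙·ᴱ (x , x') = cong₂ _,_ (map-id x) (map-id x')

𝟙+𝕦·ᴱ : ∀ {α β} (x : Elem α β) → 𝟙+𝕦 ·ᴱ x ≡ x +ᴱ (𝕦 ·ᴱ x)
𝟙+𝕦·ᴱ (x , x') = cong₂ _,_
  (trans (map-cong (λ a → sym (xor-identityʳ a)) x) (sym (zipWith-map-self _xor_ (false ∧_) x)))
  (trans (map-cong 𝟙+𝕦⊗-split x') (sym (zipWith-map-self _⊕_ (𝕦 ⊗_) x')))
  where
  𝟙+𝕦⊗-split : ∀ a → 𝟙+𝕦 ⊗ a ≡ a ⊕ (𝕦 ⊗ a)
  𝟙+𝕦⊗-split 𝟘   = refl
  𝟙+𝕦⊗-split 𝟙   = refl
  𝟙+𝕦⊗-split 𝕦   = refl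
  𝟙+𝕦⊗-split 𝟙+𝕦 = refl

u·-closed⇒isAdditiveCode : ∀ {α β} {D : Elem α β → Set} →
  D 0ᴱ → (∀ x y → D x → D y → D (x +ᴱ y)) → (∀ x → D x → D (𝕦 ·ᴱ x)) → IsAdditiveCode D
u·-closed⇒isAdditiveCode {D = D} zero-mem +-closed u·-closed = record
  { has-zero = zero-mem
  ; +-closed = +-closed
  ; ·-closed = ·-closed
  }
  where
  ·-closed : ∀ l x → D x → D (l ·ᴱ x)
  ·-closed 𝟘   x p = subst D (sym (𝟘·ᴱ x)) zero-mem
  ·-closed 𝟙   x p = subst D (sym (𝟙·ᴱ x)) p
  ·-closed 𝕦   x p = u·-closed x p
  ·-closed 𝟙+𝕦 x p = subst D (sym (𝟙+𝕦·ᴱ x)) (+-closed x (𝕦 ·ᴱ x) p (u·-closed x p))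

lemma3 : (α β : ℕ) (S : Elem α β → Set) →
    IsAdditiveCode (ΨPre {α} {β} (Span (ΨImage S)))
      ⇔ (∀ x → S x → Span (ΨImage S) (Ψ (𝕦 ·ᴱ x)))
lemma3 α β S = mk⇔ u·-generators u·-closed⇒code
  where
  T : Vec Bool (α + β * 2) → Set
  T = ΨImage S

  D : Elem α β → Set
  D = ΨPre (Span T)

  u·-generators : IsAdditiveCode D → ∀ x → S x → Span T (Ψ (𝕦 ·ᴱ x))
  u·-generators code x s = IsAdditiveCode.·-closed code 𝕦 x (span-gen (x , s , refl))

  u·-closed⇒code : (∀ x → S x → Span T (Ψ (𝕦 ·ᴱ x))) → IsAdditiveCode D
  u·-closed⇒code h = u·-closed⇒isAdditiveCode (ΨPre-0ᴱ α β Span-lin) (ΨPre-+ᴱ α β Span-lin) D-u·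
    where
    Span-lin : IsLinearCode (Span T)
    Span-lin = Span-isLinearCode T

    u·-gen : ∀ {v} → T v → Span T (u·Ψ α β v)
    u·-gen (x , s , refl) = subst (Span T) (sym (u·Ψ-Ψ x)) (h x s)

    D-u· : ∀ x → D x → D (𝕦 ·ᴱ x)
    D-u· x p = subst (Span T) (u·Ψ-Ψ x) (Span-map (u·Ψ-isLinearMap α β) Span-lin u·-gen p)
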